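{- Let $m$ be a positive integer and $u=m(m-1)\cdots 1$. A finite word $w$ over the positive integers satisfies $uw\equiv wu$ if and only if the rows $R_1,R_2,\ldots$ of $P=P(w)$ satisfy: every entry of $R_i$ is at most $m$ for all $1\le i\le m$.
   Context: $P(v)$ is the RSK insertion tableau of $v$ (row $R_1$ on top; rows beyond the last are empty) and $\equiv$ is Knuth equivalence ($v\equiv w$ iff $P(v)=P(w)$). -}

module Defs where

open import Data.Nat using (ℕ; zero; suc; _≤_; _<?_)
open import Data.List using (List; []; _∷_; _++_)
open import Data.Product using (_×_; _,_)
open import Relation.Nullary using (yes; no)
open import Relation.Binary.PropositionalEquality using (_≡_)

-- A word is a finite list of natural numbers (positivity is imposed in the statement).
Word : Set
Word = List ℕ

-- A tableau is its list of rows, top row R₁ first.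
Tableau : Set
Tableau = List (List ℕ)

data Bump : Set where
  none : Bump
  bumped : ℕ → Bump

rowInsert : ℕ → List ℕ → List ℕ × Bump
rowInsert x [] = (x ∷ [] , none)
rowInsert x (y ∷ ys) with x <? y
... | yes _ = (x ∷ ys , bumped y)
... | no _ with rowInsert x ys
...   | (ys' , b) = (y ∷ ys' , b)

insert : ℕ → Tableau → Tableau
insert x [] = (x ∷ []) ∷ []
insert x (r ∷ rs) with rowInsert x r
... | (r' , none) = r' ∷ rs
... | (r' , bumped y) = r' ∷ insert y rs

insertAll : Word → Tableau → Tableau
insertAll [] t = t
insertAll (x ∷ xs) t = insertAll xs (insert x t)

P : Word → Tableau
P w = insertAll w []

-- Knuth equivalence, as in the paper's convention: v ≡ w iff P(v) = P(w).
_≡K_ : Word → Word → Set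
v ≡K w = P v ≡ P w

-- The i-th row R_i (1-indexed); rows beyond the last (and the index 0) are empty.
row : Tableau → ℕ → List ℕ
row t zero = []
row [] (suc i) = []
row (r ∷ rs) (suc zero) = r
row (r ∷ rs) (suc (suc i)) = row rs (suc i)

decWord : ℕ → Word
decWord zero = []
decWord (suc m) = suc m ∷ decWord m

{-# OPTIONS --safe #-}
-- Write T = P(w) and u = m ⋯ 1. A letter x ≥ c inserted into a tableau whose first k rows start
-- with c, c+1, …, c+k-1 never bumps these entries, so P(uw) is T with the column 1, …, m glued to
-- the left of its first m rows, while P(wu) is obtained by inserting m, m-1, …, 1 into T. If the
-- first row is bounded by m, then m is appended and each later letter bumps its predecessor: the
-- row gains 1 at its front and m, …, 2 is passed on to the second row, and so on down. If the first
-- row has an entry above m, every letter of u bumps, so the first row does not grow, whereas it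
-- does in P(uw).
module Submission where

open import Defs
open import Data.Nat using (ℕ; zero; suc; _≤_; _<_; _>_; _+_; _<?_; _≤?_; z≤n; s≤s)
open import Data.Nat.Properties
open import Data.List using (List; []; _∷_; _++_; length; drop; applyDownFrom)
open import Data.List.Properties using (∷-injectiveˡ; ∷-injectiveʳ)
open import Data.List.Membership.Propositional using (_∈_)
open import Data.List.Relation.Unary.All as All using (All; []; _∷_; all?)
open import Data.List.Relation.Unary.All.Properties using (¬All⇒Any¬)
open import Data.List.Relation.Unary.Any as Any using (Any; here; there)
open import Data.List.Relation.Unary.AllPairs using (AllPairs; []; _∷_)
open import Data.List.Relation.Unary.Linked using (Linked; [-]; _∷_)
open import Data.Product using (_×_; _,_; proj₁; proj₂; map₂)
open import Data.Unit using (⊤; tt)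
open import Data.Empty using (⊥; ⊥-elim)
open import Relation.Nullary using (yes; no)
open import Relation.Binary.PropositionalEquality
open import Function.Bundles using (_⇔_; mk⇔; module Equivalence)
open import Function.Properties.Equivalence using () renaming (trans to ⇔-trans)

Sorted : List ℕ → Set
Sorted = AllPairs _≤_

descending : ℕ → ℕ → Word
descending c k = applyDownFrom (c +_) k

decWord≡descending : ∀ m → decWord m ≡ descending 1 m
decWord≡descending zero = refl
decWord≡descending (suc m) = cong (suc m ∷_) (decWord≡descending m)

descending-linked : ∀ c k → Linked _>_ (descending c (suc k))
descending-linked c zero = [-]
descending-linked c (suc k) = +-monoʳ-< c (n<1+n k) ∷ descending-linked c k

insertSorted : ℕ → List ℕ → List ℕ
insertSorted x [] = x ∷ []
insertSorted x (y ∷ ys) with x <? y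
... | yes _ = x ∷ y ∷ ys
... | no _ = y ∷ insertSorted x ys

insertSorted-≤All : ∀ x r → All (x ≤_) r → insertSorted x r ≡ x ∷ r
insertSorted-≤All x [] _ = refl
insertSorted-≤All x (y ∷ ys) (x≤y ∷ x≤ys) with x <? y
... | yes _ = refl
... | no x≮y with ≤-antisym (≮⇒≥ x≮y) x≤y
...   | refl = cong (x ∷_) (insertSorted-≤All x ys x≤ys)

rowInsert-All : ∀ {Q : ℕ → Set} x r → All Q r → Q x → All Q (proj₁ (rowInsert x r))
rowInsert-All x [] _ qx = qx ∷ []
rowInsert-All x (y ∷ ys) (qy ∷ qys) qx with x <? y
... | yes _ = qx ∷ qys
... | no _ with rowInsert x ys | rowInsert-All x ys qys qx
...   | _ | qys' = qy ∷ qys'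

BumpAbove : ℕ → Bump → Set
BumpAbove x none = ⊤
BumpAbove x (bumped y) = x < y

rowInsert-bumpAbove : ∀ x r → BumpAbove x (proj₂ (rowInsert x r))
rowInsert-bumpAbove x [] = tt
rowInsert-bumpAbove x (y ∷ ys) with x <? y
... | yes x<y = x<y
... | no _ with rowInsert x ys | rowInsert-bumpAbove x ys
...   | _ | above = above

rowInsert-sorted : ∀ x r → Sorted r → Sorted (proj₁ (rowInsert x r))
rowInsert-sorted x [] _ = [] ∷ []
rowInsert-sorted x (y ∷ ys) (y≤ys ∷ sorted) with x <? y
... | yes x<y = All.map (≤-trans (<⇒≤ x<y)) y≤ys ∷ sorted
... | no x≮y with rowInsert x ys | rowInsert-All x ys y≤ys (≮⇒≥ x≮y) | rowInsert-sorted x ys sorted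
...   | _ | y≤ys' | sorted' = y≤ys' ∷ sorted'

rowInsert-≥All : ∀ x r → All (_≤ x) r → rowInsert x r ≡ (insertSorted x r , none)
rowInsert-≥All x [] _ = refl
rowInsert-≥All x (y ∷ ys) (y≤x ∷ ys≤x) with x <? y
... | yes x<y = ⊥-elim (<⇒≱ x<y y≤x)
... | no _ rewrite rowInsert-≥All x ys ys≤x = refl

rowInsert-insertSorted-suc : ∀ x r → Sorted r →
  rowInsert x (insertSorted (suc x) r) ≡ (insertSorted x r , bumped (suc x))
rowInsert-insertSorted-suc x [] _ with x <? suc x
... | yes _ = refl
... | no x≮1+x = ⊥-elim (x≮1+x (n<1+n x))
rowInsert-insertSorted-suc x (y ∷ ys) (y≤ys ∷ sorted) with suc x <? y
... | yes 1+x<y with x <? suc x | x <? y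
...   | yes _ | yes _ = refl
...   | no x≮1+x | _ = ⊥-elim (x≮1+x (n<1+n x))
...   | yes _ | no x≮y = ⊥-elim (x≮y (<-trans (n<1+n x) 1+x<y))
rowInsert-insertSorted-suc x (y ∷ ys) (y≤ys ∷ sorted) | no 1+x≮y with x <? y
...   | no _ rewrite rowInsert-insertSorted-suc x ys sorted = refl
...   | yes x<y with ≤-antisym (≮⇒≥ 1+x≮y) x<y
...     | refl rewrite insertSorted-≤All (suc x) ys y≤ys = refl

rowInsertAll : Word → List ℕ → List ℕ × Word
rowInsertAll [] r = (r , [])
rowInsertAll (x ∷ xs) r with rowInsert x r
... | (r' , none) = rowInsertAll xs r'
... | (r' , bumped y) = map₂ (y ∷_) (rowInsertAll xs r')

rowInsertAll-descending-insertSorted : ∀ c k r → Sorted r →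
  rowInsertAll (descending c k) (insertSorted (c + k) r) ≡ (insertSorted c r , descending (suc c) k)
rowInsertAll-descending-insertSorted c zero r _ rewrite +-identityʳ c = refl
rowInsertAll-descending-insertSorted c (suc k) r sorted
  rewrite +-suc c k
        | rowInsert-insertSorted-suc (c + k) r sorted
        | rowInsertAll-descending-insertSorted c k r sorted = refl

rowInsertAll-descending-bounded : ∀ c k r → Sorted r → All (c ≤_) r → All (_≤ c + k) r →
  rowInsertAll (descending c (suc k)) r ≡ (c ∷ r , descending (suc c) k)
rowInsertAll-descending-bounded c k r sorted c≤r r≤c+k
  rewrite rowInsert-≥All (c + k) r r≤c+k
        | rowInsertAll-descending-insertSorted c k r sorted
        | insertSorted-≤All c r c≤r = refl

IsBumped : Bump → Set
IsBumped none = ⊥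
IsBumped (bumped _) = ⊤

rowInsert-bumping : ∀ x r → Any (x <_) r →
  let (r' , b) = rowInsert x r in IsBumped b × length r' ≡ length r × x ∈ r'
rowInsert-bumping x (y ∷ ys) x<y∷ys with x <? y | x<y∷ys
... | yes _ | _ = tt , refl , here refl
... | no x≮y | here x<y = ⊥-elim (x≮y x<y)
... | no _ | there x<ys with rowInsert x ys | rowInsert-bumping x ys x<ys
...   | _ | isBumped , sameLength , x∈ = isBumped , cong suc sameLength , there x∈

rowInsertAll-decreasing-length : ∀ x xs r → Linked _>_ (x ∷ xs) → Any (x <_) r →
  length (proj₁ (rowInsertAll (x ∷ xs) r)) ≡ length r
rowInsertAll-decreasing-length x xs r decreasing x<r
  with rowInsert x r | rowInsert-bumping x r x<r
... | (_ , none) | () , _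
... | (r' , bumped _) | _ , sameLength , x∈r' with decreasing
...   | [-] = sameLength
...   | y<x ∷ decreasing' = trans
        (rowInsertAll-decreasing-length _ _ r' decreasing' (Any.map (λ { refl → y<x }) x∈r'))
        sameLength

headRow : Tableau → List ℕ
headRow T = row T 1

tailRows : Tableau → Tableau
tailRows = drop 1

prependColumn : ℕ → ℕ → Tableau → Tableau
prependColumn c zero T = T
prependColumn c (suc k) T = (c ∷ headRow T) ∷ prependColumn (suc c) k (tailRows T)

TopRowsBounded : ℕ → ℕ → Tableau → Set
TopRowsBounded M zero T = ⊤
TopRowsBounded M (suc k) T = All (_≤ M) (headRow T) × TopRowsBounded M k (tailRows T)

TopRowsBounded-[] : ∀ M k → TopRowsBounded M k []
TopRowsBounded-[] M zero = tt
TopRowsBounded-[] M (suc k) = [] , TopRowsBounded-[] M k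

TopRowsBounded⇔rows : ∀ M k T →
  TopRowsBounded M k T ⇔ ((i : ℕ) → 1 ≤ i → i ≤ k → All (_≤ M) (row T i))
TopRowsBounded⇔rows M k T = mk⇔ (to k T) (from k T)
  where
  row-tailRows : ∀ T i → row T (suc (suc i)) ≡ row (tailRows T) (suc i)
  row-tailRows [] i = refl
  row-tailRows (r ∷ rs) i = refl

  to : ∀ k T → TopRowsBounded M k T → (i : ℕ) → 1 ≤ i → i ≤ k → All (_≤ M) (row T i)
  to (suc k) T (first , rest) (suc zero) _ _ = first
  to (suc k) T (first , rest) (suc (suc i)) _ (s≤s i<k) =
    subst (All (_≤ M)) (sym (row-tailRows T i)) (to k (tailRows T) rest (suc i) (s≤s z≤n) i<k)

  from : ∀ k T → ((i : ℕ) → 1 ≤ i → i ≤ k → All (_≤ M) (row T i)) → TopRowsBounded M k T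
  from zero T _ = tt
  from (suc k) T bounded = bounded 1 (s≤s z≤n) (s≤s z≤n) , from k (tailRows T) λ where
    (suc i) _ i≤k → subst (All (_≤ M)) (row-tailRows T i) (bounded (suc (suc i)) (s≤s z≤n) (s≤s i≤k))

-- Only the part of semistandardness that the argument uses.
SortedRowsFrom : ℕ → Tableau → Set
SortedRowsFrom c [] = ⊤
SortedRowsFrom c (r ∷ rs) = Sorted r × All (c ≤_) r × SortedRowsFrom (suc c) rs

SortedRowsFrom-uncons : ∀ {c} T → SortedRowsFrom c T →
  Sorted (headRow T) × All (c ≤_) (headRow T) × SortedRowsFrom (suc c) (tailRows T)
SortedRowsFrom-uncons [] _ = [] , [] , tt
SortedRowsFrom-uncons (r ∷ rs) sortedRows = sortedRows

insert-SortedRowsFrom : ∀ c x T → SortedRowsFrom c T → c ≤ x → SortedRowsFrom c (insert x T)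
insert-SortedRowsFrom c x [] _ c≤x = [] ∷ [] , c≤x ∷ [] , tt
insert-SortedRowsFrom c x (r ∷ rs) (sorted , c≤r , sortedRows) c≤x
  with rowInsert x r | rowInsert-sorted x r sorted | rowInsert-All x r c≤r c≤x | rowInsert-bumpAbove x r
... | (r' , none) | sorted' | c≤r' | _ = sorted' , c≤r' , sortedRows
... | (r' , bumped y) | sorted' | c≤r' | x<y =
  sorted' , c≤r' , insert-SortedRowsFrom (suc c) y rs sortedRows (<-≤-trans (s≤s c≤x) x<y)

insertAll-SortedRowsFrom : ∀ c w T → SortedRowsFrom c T → All (c ≤_) w → SortedRowsFrom c (insertAll w T)
insertAll-SortedRowsFrom c [] T sortedRows _ = sortedRows
insertAll-SortedRowsFrom c (x ∷ w) T sortedRows (c≤x ∷ c≤w) =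
  insertAll-SortedRowsFrom c w (insert x T) (insert-SortedRowsFrom c x T sortedRows c≤x) c≤w

insertAll-++ : ∀ v w T → insertAll (v ++ w) T ≡ insertAll w (insertAll v T)
insertAll-++ [] w T = refl
insertAll-++ (x ∷ v) w T = insertAll-++ v w (insert x T)

insert-prependColumn : ∀ c k x T → c ≤ x → insert x (prependColumn c k T) ≡ prependColumn c k (insert x T)
insert-prependColumn c zero x T _ = refl
insert-prependColumn c (suc k) x T c≤x with x <? c
... | yes x<c = ⊥-elim (<⇒≱ x<c c≤x)
insert-prependColumn c (suc k) x [] c≤x | no _ = refl
insert-prependColumn c (suc k) x (r ∷ rs) c≤x | no _ with rowInsert x r | rowInsert-bumpAbove x r
... | (r' , none) | _ = refl
... | (r' , bumped y) | x<y =
  cong ((c ∷ r') ∷_) (insert-prependColumn (suc c) k y rs (<-≤-trans (s≤s c≤x) x<y))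

insertAll-prependColumn : ∀ c k w T → All (c ≤_) w →
  insertAll w (prependColumn c k T) ≡ prependColumn c k (insertAll w T)
insertAll-prependColumn c k [] T _ = refl
insertAll-prependColumn c k (x ∷ w) T (c≤x ∷ c≤w)
  rewrite insert-prependColumn c k x T c≤x = insertAll-prependColumn c k w (insert x T) c≤w

insertAll-rowwise : ∀ xs r rs →
  insertAll xs (r ∷ rs) ≡ (let (r' , b) = rowInsertAll xs r in r' ∷ insertAll b rs)
insertAll-rowwise [] r rs = refl
insertAll-rowwise (x ∷ xs) r rs with rowInsert x r
... | (r' , none) = insertAll-rowwise xs r' rs
... | (r' , bumped y) = insertAll-rowwise xs r' (insert y rs)

insertAll-headRow : ∀ x xs T →
  insertAll (x ∷ xs) T ≡ (let (r' , b) = rowInsertAll (x ∷ xs) (headRow T) in r' ∷ insertAll b (tailRows T))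
insertAll-headRow x xs [] = insertAll-rowwise xs (x ∷ []) []
insertAll-headRow x xs (r ∷ rs) = insertAll-rowwise (x ∷ xs) r rs

insertAll-descending-boundedRow : ∀ c k T → SortedRowsFrom c T → All (_≤ c + k) (headRow T) →
  insertAll (descending c (suc k)) T ≡ (c ∷ headRow T) ∷ insertAll (descending (suc c) k) (tailRows T)
insertAll-descending-boundedRow c k T sortedRows headRow≤c+k =
  let (sorted , c≤headRow , _) = SortedRowsFrom-uncons T sortedRows in
  trans (insertAll-headRow (c + k) (descending c k) T)
        (cong (λ (r' , b) → r' ∷ insertAll b (tailRows T))
              (rowInsertAll-descending-bounded c k (headRow T) sorted c≤headRow headRow≤c+k))

prependColumn≢insertAll-descending : ∀ c k T → Any (c + k <_) (headRow T) →
  prependColumn c (suc k) T ≢ insertAll (descending c (suc k)) T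
prependColumn≢insertAll-descending c k T c+k<headRow eq = 1+n≢n (begin
  suc (length (headRow T))                                          ≡⟨ cong length firstRows ⟩
  length (proj₁ (rowInsertAll (descending c (suc k)) (headRow T)))  ≡⟨ rowInsertAll-decreasing-length
                                                                         (c + k) (descending c k) (headRow T)
                                                                         (descending-linked c k) c+k<headRow ⟩
  length (headRow T)                                                ∎)
  where
  open ≡-Reasoning
  firstRows : c ∷ headRow T ≡ proj₁ (rowInsertAll (descending c (suc k)) (headRow T))
  firstRows = ∷-injectiveˡ (trans eq (insertAll-headRow (c + k) (descending c k) T))

prependColumn≡insertAll-descending⇔TopRowsBounded : ∀ c k T → SortedRowsFrom c T →
  (prependColumn c (suc k) T ≡ insertAll (descending c (suc k)) T) ⇔ TopRowsBounded (c + k) (suc k) T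
prependColumn≡insertAll-descending⇔TopRowsBounded c k T sortedRows with all? (_≤? c + k) (headRow T)
... | no unbounded = mk⇔
  (λ eq → ⊥-elim (prependColumn≢insertAll-descending c k T
                   (Any.map ≰⇒> (¬All⇒Any¬ (_≤? c + k) (headRow T) unbounded)) eq))
  (λ (bounded , _) → ⊥-elim (unbounded bounded))
... | yes bounded = mk⇔
  (λ eq → bounded , Equivalence.to (lowerRows k) (∷-injectiveʳ (trans eq firstRow)))
  (λ (_ , lowerBounded) → trans (cong ((c ∷ headRow T) ∷_) (Equivalence.from (lowerRows k) lowerBounded))
                                (sym firstRow))
  where
  firstRow : insertAll (descending c (suc k)) T
             ≡ (c ∷ headRow T) ∷ insertAll (descending (suc c) k) (tailRows T)
  firstRow = insertAll-descending-boundedRow c k T sortedRows bounded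

  LowerRowsCommute : ℕ → Set
  LowerRowsCommute j = prependColumn (suc c) j (tailRows T) ≡ insertAll (descending (suc c) j) (tailRows T)
  lowerRows : ∀ j → LowerRowsCommute j ⇔ TopRowsBounded (c + j) j (tailRows T)
  lowerRows zero = mk⇔ (λ _ → tt) (λ _ → refl)
  lowerRows (suc j) =
    subst (λ M → LowerRowsCommute (suc j) ⇔ TopRowsBounded M (suc j) (tailRows T)) (sym (+-suc c j))
      (prependColumn≡insertAll-descending⇔TopRowsBounded (suc c) j (tailRows T)
        (proj₂ (proj₂ (SortedRowsFrom-uncons T sortedRows))))

P-decWord : ∀ k → P (decWord (suc k)) ≡ prependColumn 1 (suc k) []
P-decWord k = begin
  P (decWord (suc k))                   ≡⟨ cong (λ v → insertAll v []) (decWord≡descending (suc k)) ⟩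
  insertAll (descending 1 (suc k)) []   ≡⟨ sym (Equivalence.from
                                             (prependColumn≡insertAll-descending⇔TopRowsBounded 1 k [] tt)
                                             (TopRowsBounded-[] (suc k) (suc k))) ⟩
  prependColumn 1 (suc k) []            ∎
  where open ≡-Reasoning

P-decWord-++ : ∀ k w → All (1 ≤_) w → P (decWord (suc k) ++ w) ≡ prependColumn 1 (suc k) (P w)
P-decWord-++ k w positive = begin
  P (decWord (suc k) ++ w)                  ≡⟨ insertAll-++ (decWord (suc k)) w [] ⟩
  insertAll w (P (decWord (suc k)))         ≡⟨ cong (insertAll w) (P-decWord k) ⟩
  insertAll w (prependColumn 1 (suc k) [])  ≡⟨ insertAll-prependColumn 1 (suc k) w [] positive ⟩
  prependColumn 1 (suc k) (P w)             ∎
  where open ≡-Reasoning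

P-++-decWord : ∀ m w → P (w ++ decWord m) ≡ insertAll (descending 1 m) (P w)
P-++-decWord m w = begin
  P (w ++ decWord m)                ≡⟨ insertAll-++ w (decWord m) [] ⟩
  insertAll (decWord m) (P w)       ≡⟨ cong (λ v → insertAll v (P w)) (decWord≡descending m) ⟩
  insertAll (descending 1 m) (P w)  ∎
  where open ≡-Reasoning

theorem4p3 : (m : ℕ) → 1 ≤ m → (w : Word) → All (1 ≤_) w →
    ((decWord m ++ w) ≡K (w ++ decWord m)) ⇔
    ((i : ℕ) → 1 ≤ i → i ≤ m → All (_≤ m) (row (P w) i))
theorem4p3 (suc k) _ w positive =
  ⇔-trans (mk⇔ (λ eq → trans (sym uw) (trans eq wu)) (λ eq → trans uw (trans eq (sym wu))))
    (⇔-trans (prependColumn≡insertAll-descending⇔TopRowsBounded 1 k (P w) sortedRows)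
      (TopRowsBounded⇔rows (suc k) (suc k) (P w)))
  where
  uw = P-decWord-++ k w positive
  wu = P-++-decWord (suc k) w
  sortedRows = insertAll-SortedRowsFrom 1 w [] tt positive
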